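{- For every integer $d \ge 0$ there is a polynomial $P_d$, whose degree is linear in $d$, such that for every term $t$ of depth $d(t)=d$, every sequence of one-step reductions $t = t_0 \to t_1 \to \cdots \to t_m$ starting from $t$ has length $m \le P_d(|t|)$.
   Context: Pseudo-terms are given by the grammar $t ::= x \mid \lambda x.t \mid (t\,t') \mid\, !t \mid \mathrm{let}\ t\ \mathrm{be}\ !x\ \mathrm{in}\ t'$. In $\mathrm{let}\ u\ \mathrm{be}\ !x\ \mathrm{in}\ t_1$ the variable $x$ is bound in $t_1$: $FV(\mathrm{let}\ u\ \mathrm{be}\ !x\ \mathrm{in}\ t_1)=FV(u)\cup(FV(t_1)\setminus\{x\})$; $\lambda$ binds as usual. $FV(t)$ is the set of free variables of $t$, and $no(x,t)$ is the number of free occurrences of $x$ in $t$. Terms and their sets of temporary variables $TV(t)\subseteq FV(t)$ are defined simultaneously as the smallest set of pseudo-terms such that: (i) a variable $x$ is a term, $TV(x)=\emptyset$; (ii) $\lambda x.t$ is a term iff $t$ is a term, $x\notin TV(t)$ and $no(x,t)\le 1$, and then $TV(\lambda x.t)=TV(t)$; (iii) $(t_1\,t_2)$ is a term iff $t_1,t_2$ are terms, $TV(t_1)\cap FV(t_2)=\emptyset$ and $FV(t_1)\cap TV(t_2)=\emptyset$, and then $TV(t_1\,t_2)=TV(t_1)\cup TV(t_2)$; (iv) $!t$ is a term iff $t$ is a term, $TV(t)=\emptyset$ and $no(x,t)=1$ for all $x\in FV(t)$, and then $TV(!t)=FV(t)$; (v) $\mathrm{let}\ t_1\ \mathrm{be}\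 !x\ \mathrm{in}\ t_2$ is a term iff $t_1,t_2$ are terms, $TV(t_1)\cap FV(t_2)=\emptyset$ and $FV(t_1)\cap TV(t_2)=\emptyset$, and then its $TV$ is $TV(t_1)\cup(TV(t_2)\setminus\{x\})$. Size: $|x|=1$, $|\lambda x.t|=|t|+1$, $|(t\,t')|=|t|+|t'|$, $|!t|=|t|+1$, $|\mathrm{let}\ t\ \mathrm{be}\ !x\ \mathrm{in}\ t'|=|t|+|t'|+1$. Depth: for an occurrence $u$ of a subterm of $t$, its depth in $t$ is the number of subterm occurrences $v$ of $t$ of the form $!v'$ such that $u$ is a subterm of $v$; the depth $d(t)$ of $t$ is the maximum depth of its subterm occurrences. One-step reduction $\to$ is the contextual closure of the rules: $(\beta)$ $((\lambda x.t)\,u)\to t[u/x]$; (bang) $\mathrm{let}\ !u\ \mathrm{be}\ !x\ \mathrm{in}\ t\to t[u/x]$; (com1) $\mathrm{let}\ (\mathrm{let}\ t_1\ \mathrm{be}\ !y\ \mathrm{in}\ t_2)\ \mathrm{be}\ !x\ \mathrm{in}\ t_3 \to \mathrm{let}\ t_1\ \mathrm{be}\ !y\ \mathrm{in}\ (\mathrm{let}\ t_2\ \mathrm{be}\ !x\ \mathrm{in}\ t_3)$; (com2) $((\mathrm{let}\ t_1\ \mathrm{be}\ !x\ \mathrm{in}\ t_2)\ t_3)\to \mathrm{let}\ t_1\ \mathrm{be}\ !x\ \mathrm{in}\ (t_2\,t_3)$. Here $t[u/x]$ denotes capture-avoiding substitution. -}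

module Defs where

open import Data.Nat using (ℕ; zero; suc; _+_; _*_; _≤_; _<_; _⊔_; _≡ᵇ_; _<ᵇ_)
open import Data.Bool using (if_then_else_)
open import Data.List using (List; []; _∷_)
open import Data.Sum using (_⊎_)
open import Data.Empty using (⊥)
open import Relation.Nullary using (¬_)
open import Relation.Binary.PropositionalEquality using (_≡_)

-- Pseudo-terms in de Bruijn notation (variables are indices; terms are
-- thus identified up to alpha-equivalence, as in the paper).
--   lam t      = λx.t            (x is index 0 in t)
--   letb u t   = let u be !x in t (x is index 0 in t, u is outside the binder)
data Tm : Set where
  var  : ℕ → Tm
  lam  : Tm → Tm
  app  : Tm → Tm → Tm
  bang : Tm → Tm
  letb : Tm → Tm → Tm

no : ℕ → Tm → ℕ
no x (var y)    = if x ≡ᵇ y then 1 else 0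
no x (lam t)    = no (suc x) t
no x (app t u)  = no x t + no x u
no x (bang t)   = no x t
no x (letb u t) = no x u + no (suc x) t

_∈FV_ : ℕ → Tm → Set
x ∈FV t = 0 < no x t

_∈TV_ : ℕ → Tm → Set
x ∈TV var y    = ⊥
x ∈TV lam t    = suc x ∈TV t
x ∈TV app t u  = x ∈TV t ⊎ x ∈TV u
x ∈TV bang t   = x ∈FV t
x ∈TV letb u t = x ∈TV u ⊎ suc x ∈TV t

data IsTerm : Tm → Set where
  t-var  : ∀ x → IsTerm (var x)
  t-lam  : ∀ {t} → IsTerm t → ¬ (0 ∈TV t) → no 0 t ≤ 1 → IsTerm (lam t)
  t-app  : ∀ {t₁ t₂} → IsTerm t₁ → IsTerm t₂
         → (∀ x → x ∈TV t₁ → ¬ (x ∈FV t₂))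
         → (∀ x → x ∈FV t₁ → ¬ (x ∈TV t₂))
         → IsTerm (app t₁ t₂)
  t-bang : ∀ {t} → IsTerm t → (∀ x → ¬ (x ∈TV t))
         → (∀ x → x ∈FV t → no x t ≡ 1)
         → IsTerm (bang t)
  -- free variables of the body t₂ of "let t₁ be !x in t₂" other than x
  -- are the indices suc y
  t-letb : ∀ {t₁ t₂} → IsTerm t₁ → IsTerm t₂
         → (∀ y → y ∈TV t₁ → ¬ (suc y ∈FV t₂))
         → (∀ y → y ∈FV t₁ → ¬ (suc y ∈TV t₂))
         → IsTerm (letb t₁ t₂)

size : Tm → ℕ
size (var x)    = 1
size (lam t)    = suc (size t)
size (app t u)  = size t + size u
size (bang t)   = suc (size t)
size (letb u t) = suc (size u + size t)

depth : Tm → ℕ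
depth (var x)    = 0
depth (lam t)    = depth t
depth (app t u)  = depth t ⊔ depth u
depth (bang t)   = suc (depth t)
depth (letb u t) = depth u ⊔ depth t

shift : ℕ → Tm → Tm
shift c (var y)    = if y <ᵇ c then var y else var (suc y)
shift c (lam t)    = lam (shift (suc c) t)
shift c (app t u)  = app (shift c t) (shift c u)
shift c (bang t)   = bang (shift c t)
shift c (letb u t) = letb (shift c u) (shift (suc c) t)

subst : ℕ → Tm → Tm → Tm
subst k u (var y) =
  if y ≡ᵇ k then u else (if y <ᵇ k then var y else var (Data.Nat.pred y))
subst k u (lam t)    = lam (subst (suc k) (shift 0 u) t)
subst k u (app t s)  = app (subst k u t) (subst k u s)
subst k u (bang t)   = bang (subst k u t)
subst k u (letb s t) = letb (subst k u s) (subst (suc k) (shift 0 u) t)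

_[_] : Tm → Tm → Tm
t [ u ] = subst 0 u t

infix 4 _⟶_
data _⟶_ : Tm → Tm → Set where
  β     : ∀ {t u} → app (lam t) u ⟶ t [ u ]
  bangR : ∀ {u t} → letb (bang u) t ⟶ t [ u ]
  com1  : ∀ {t₁ t₂ t₃} →
          letb (letb t₁ t₂) t₃ ⟶ letb t₁ (letb t₂ (shift 1 t₃))
  com2  : ∀ {t₁ t₂ t₃} →
          app (letb t₁ t₂) t₃ ⟶ letb t₁ (app t₂ (shift 0 t₃))
  ξ-lam   : ∀ {t t'} → t ⟶ t' → lam t ⟶ lam t'
  ξ-appₗ  : ∀ {t t' u} → t ⟶ t' → app t u ⟶ app t' u
  ξ-appᵣ  : ∀ {t u u'} → u ⟶ u' → app t u ⟶ app t u'
  ξ-bang  : ∀ {t t'} → t ⟶ t' → bang t ⟶ bang t'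
  ξ-letₗ  : ∀ {u u' t} → u ⟶ u' → letb u t ⟶ letb u' t
  ξ-letᵣ  : ∀ {u t t'} → t ⟶ t' → letb u t ⟶ letb u t'

data _⟶[_]_ : Tm → ℕ → Tm → Set where
  done : ∀ {t} → t ⟶[ 0 ] t
  step : ∀ {t t₁ t' m} → t ⟶ t₁ → t₁ ⟶[ m ] t' → t ⟶[ suc m ] t'

-- polynomials with natural-number coefficients: [a₀, a₁, ..., aₖ]
eval : List ℕ → ℕ → ℕ
eval []       n = 0
eval (a ∷ as) n = a + n * eval as n

{-# OPTIONS --safe #-}
-- Take N = |t| and let a box multiply by N both the weight of its contents,
-- weight (!u) = 1 + N · weight u, and the count of the variable occurrences inside
-- it. In a term of size ≤ N a λ-bound variable then has weighted count ≤ 1 and a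
-- let-bound one count ≤ N: a temporary variable occurs once, inside a single box,
-- and any other variable occurs only outside boxes. These bounds survive reduction
-- and weighted counts never increase, so β and bang strictly decrease the weight,
-- while com1 and com2 preserve it and decrease comWeight ≤ weight², the total
-- weight of the left operands of applications and lets. As weight t < N ^ (d + 1)
-- = Q, the potential weight · Q² + comWeight decreases at every step and starts
-- below Q³ = N ^ (3d + 3).
module Submission where

open import Defs
open import Data.Nat using (ℕ; zero; suc; _+_; _*_; _^_; _≤_; _<_; _⊔_; _≡ᵇ_; _<ᵇ_; z≤n; s≤s; z<s; s<s; NonZero; >-nonZero; >-nonZero⁻¹)
open import Data.Nat.Properties
open import Data.Nat.Tactic.RingSolver using (solve-∀)
open import Algebra.Properties.CommutativeSemigroup *-commutativeSemigroup using (x∙yz≈y∙xz)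
open import Data.Bool using (true; false; if_then_else_)
open import Data.List using (List; []; _∷_; length)
open import Data.Sum using (inj₁; inj₂)
open import Data.Product using (Σ; _×_; _,_)
open import Data.Product.Relation.Binary.Lex.Strict using (×-Lex)
open import Data.Unit using (⊤; tt)
open import Relation.Nullary using (¬_)
open import Relation.Nullary.Decidable as Dec using (Dec; yes; _⊎-dec_; dec-true; dec-false)
open import Relation.Binary.Definitions using (tri<; tri≈; tri>)
open import Relation.Binary.PropositionalEquality
  using (_≡_; _≢_; refl; sym; trans; cong; cong₂; module ≡-Reasoning)

≡ᵇ-refl : ∀ n → (n ≡ᵇ n) ≡ true
≡ᵇ-refl n = dec-true (n ≟ n) refl

≢⇒≡ᵇ-false : ∀ {m n} → m ≢ n → (m ≡ᵇ n) ≡ false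
≢⇒≡ᵇ-false {m} {n} = dec-false (m ≟ n)

<⇒<ᵇ-true : ∀ {m n} → m < n → (m <ᵇ n) ≡ true
<⇒<ᵇ-true {m} {n} = dec-true (m <? n)

≥⇒<ᵇ-false : ∀ {m n} → n ≤ m → (m <ᵇ n) ≡ false
≥⇒<ᵇ-false {m} {n} n≤m = dec-false (m <? n) (≤⇒≯ n≤m)

collect-+ : ∀ a b c d e → a + b * e + (c + d * e) ≡ a + c + (b + d) * e
collect-+ = solve-∀

collect-* : ∀ m a b e → m * (a + b * e) ≡ m * a + m * b * e
collect-* = solve-∀

m*o+n<[1+m]*o : ∀ m {n} o → n < o → m * o + n < suc m * o
m*o+n<[1+m]*o m {n} o n<o = begin-strict
  m * o + n  <⟨ +-monoʳ-< (m * o) n<o ⟩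
  m * o + o  ≡⟨ +-comm (m * o) o ⟩
  suc m * o  ∎
  where open ≤-Reasoning

node-square : ∀ {a b c₁ c₂} → c₁ ≤ a * a → c₂ ≤ b * b → a + c₁ + c₂ ≤ suc (a + b) * suc (a + b)
node-square {a} {b} {c₁} {c₂} c₁≤a² c₂≤b² = begin
  a + c₁ + c₂                                      ≤⟨ +-mono-≤ (+-monoʳ-≤ a c₁≤a²) c₂≤b² ⟩
  a + a * a + b * b                                ≤⟨ m≤m+n _ _ ⟩
  a + a * a + b * b + (1 + a + 2 * b + 2 * a * b)  ≡⟨ expand a b ⟩
  suc (a + b) * suc (a + b)                        ∎
  where
  open ≤-Reasoning
  expand : ∀ a b → a + a * a + b * b + (1 + a + 2 * b + 2 * a * b) ≡ suc (a + b) * suc (a + b)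
  expand = solve-∀

^-cube : ∀ m n → m ^ (3 * n + 3) ≡ m ^ suc n * (m ^ suc n * m ^ suc n)
^-cube m n = begin
  m ^ (3 * n + 3)                       ≡⟨ cong (m ^_) (three-copies n) ⟩
  m ^ (suc n + (suc n + suc n))         ≡⟨ ^-distribˡ-+-* m (suc n) (suc n + suc n) ⟩
  m ^ suc n * m ^ (suc n + suc n)       ≡⟨ cong (m ^ suc n *_) (^-distribˡ-+-* m (suc n) (suc n)) ⟩
  m ^ suc n * (m ^ suc n * m ^ suc n)   ∎
  where
  open ≡-Reasoning
  three-copies : ∀ n → 3 * n + 3 ≡ suc n + (suc n + suc n)
  three-copies = solve-∀

_<lex_ : ℕ × ℕ → ℕ × ℕ → Set
_<lex_ = ×-Lex _≡_ _<_ _<_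

<lex-map₁ : (f : ℕ → ℕ) → (∀ {a b} → a < b → f a < f b) →
  ∀ {w' c' w c} → (w' , c') <lex (w , c) → (f w' , c') <lex (f w , c)
<lex-map₁ f f-mono (inj₁ w'<w)          = inj₁ (f-mono w'<w)
<lex-map₁ f f-mono (inj₂ (refl , c'<c)) = inj₂ (refl , c'<c)

<lex-nodeˡ : ∀ {w' c' w c} v e → (w' , c') <lex (w , c) →
  (suc (w' + v) , w' + c' + e) <lex (suc (w + v) , w + c + e)
<lex-nodeˡ v e (inj₁ w'<w)          = inj₁ (s<s (+-monoˡ-< v w'<w))
<lex-nodeˡ v e (inj₂ (refl , c'<c)) = inj₂ (refl , +-monoˡ-< e (+-monoʳ-< _ c'<c))

<lex-nodeʳ : ∀ {w' c' w c} v e → (w' , c') <lex (w , c) →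
  (suc (v + w') , v + e + c') <lex (suc (v + w) , v + e + c)
<lex-nodeʳ v e (inj₁ w'<w)          = inj₁ (s<s (+-monoʳ-< v w'<w))
<lex-nodeʳ v e (inj₂ (refl , c'<c)) = inj₂ (refl , +-monoʳ-< (v + e) c'<c)

<lex-commute : ∀ w₁ w₂ w₃ c₁ c₂ c₃ →
  (suc (w₁ + suc (w₂ + w₃)) , w₁ + c₁ + (w₂ + c₂ + c₃))
    <lex (suc (suc (w₁ + w₂) + w₃) , suc (w₁ + w₂) + (w₁ + c₁ + c₂) + c₃)
<lex-commute w₁ w₂ w₃ c₁ c₂ c₃ = inj₂ (reassociate w₁ w₂ w₃ , c-<)
  where
  reassociate : ∀ w₁ w₂ w₃ → suc (w₁ + suc (w₂ + w₃)) ≡ suc (suc (w₁ + w₂) + w₃)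
  reassociate = solve-∀
  rearrange : ∀ w₁ w₂ c₁ c₂ c₃ →
    suc (w₁ + c₁ + (w₂ + c₂ + c₃) + w₁) ≡ suc (w₁ + w₂) + (w₁ + c₁ + c₂) + c₃
  rearrange = solve-∀
  open ≤-Reasoning
  c-< : w₁ + c₁ + (w₂ + c₂ + c₃) < suc (w₁ + w₂) + (w₁ + c₁ + c₂) + c₃
  c-< = begin-strict
    w₁ + c₁ + (w₂ + c₂ + c₃)             ≤⟨ m≤m+n _ w₁ ⟩
    w₁ + c₁ + (w₂ + c₂ + c₃) + w₁        <⟨ n<1+n _ ⟩
    suc (w₁ + c₁ + (w₂ + c₂ + c₃) + w₁)  ≡⟨ rearrange w₁ w₂ c₁ c₂ c₃ ⟩
    suc (w₁ + w₂) + (w₁ + c₁ + c₂) + c₃  ∎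

<lex⇒≤₁ : ∀ {w' c' w c} → (w' , c') <lex (w , c) → w' ≤ w
<lex⇒≤₁ (inj₁ w'<w)       = <⇒≤ w'<w
<lex⇒≤₁ (inj₂ (refl , _)) = ≤-refl

<lex⇒weighted-< : ∀ {w' c' w c} K → c' < K → (w' , c') <lex (w , c) → w' * K + c' < w * K + c
<lex⇒weighted-< {w'} {c'} {w} {c} K c'<K (inj₁ w'<w) = begin-strict
  w' * K + c'  <⟨ m*o+n<[1+m]*o w' K c'<K ⟩
  suc w' * K   ≤⟨ *-monoˡ-≤ K w'<w ⟩
  w * K        ≤⟨ m≤m+n (w * K) c ⟩
  w * K + c    ∎
  where open ≤-Reasoning
<lex⇒weighted-< {w'} K c'<K (inj₂ (refl , c'<c)) = +-monoʳ-< (w' * K) c'<c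

size>0 : ∀ t → 0 < size t
size>0 (var x)    = z<s
size>0 (lam t)    = z<s
size>0 (app t u)  = <-≤-trans (size>0 t) (m≤m+n (size t) (size u))
size>0 (bang t)   = z<s
size>0 (letb u t) = z<s

no≤size : ∀ x t → no x t ≤ size t
no≤size x (var y) with x ≡ᵇ y
... | true  = ≤-refl
... | false = z≤n
no≤size x (lam t)    = m≤n⇒m≤1+n (no≤size (suc x) t)
no≤size x (app t u)  = +-mono-≤ (no≤size x t) (no≤size x u)
no≤size x (bang t)   = m≤n⇒m≤1+n (no≤size x t)
no≤size x (letb u t) = m≤n⇒m≤1+n (+-mono-≤ (no≤size x u) (no≤size (suc x) t))

∉FV⇒no≡0 : ∀ x t → ¬ x ∈FV t → no x t ≡ 0
∉FV⇒no≡0 x t x∉t = n≤0⇒n≡0 (≮⇒≥ x∉t)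

_∈TV?_ : ∀ x t → Dec (x ∈TV t)
x ∈TV? var y    = Dec.no λ ()
x ∈TV? lam t    = suc x ∈TV? t
x ∈TV? app t u  = (x ∈TV? t) ⊎-dec (x ∈TV? u)
x ∈TV? bang t   = 0 <? no x t
x ∈TV? letb u t = (x ∈TV? u) ⊎-dec (suc x ∈TV? t)

length≤measure : (Inv : Tm → Set) (μ : Tm → ℕ) →
  (∀ {s s'} → s ⟶ s' → Inv s → Inv s' × μ s' < μ s) →
  ∀ {t t' m} → t ⟶[ m ] t' → Inv t → m ≤ μ t
length≤measure Inv μ decrease done         _   = z≤n
length≤measure Inv μ decrease (step r red) inv with decrease r inv
... | inv' , μ-< = ≤-trans (s≤s (length≤measure Inv μ decrease red inv')) μ-<

module WeightedMeasure (N : ℕ) .{{_ : NonZero N}} where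

  occ : ℕ → Tm → ℕ
  occ x (var y)    = if x ≡ᵇ y then 1 else 0
  occ x (lam t)    = occ (suc x) t
  occ x (app t u)  = occ x t + occ x u
  occ x (bang t)   = N * occ x t
  occ x (letb u t) = occ x u + occ (suc x) t

  weight : Tm → ℕ
  weight (var y)    = 0
  weight (lam t)    = suc (weight t)
  weight (app t u)  = suc (weight t + weight u)
  weight (bang t)   = suc (N * weight t)
  weight (letb u t) = suc (weight u + weight t)

  comWeight : Tm → ℕ
  comWeight (var y)    = 0
  comWeight (lam t)    = comWeight t
  comWeight (app t u)  = weight t + comWeight t + comWeight u
  comWeight (bang t)   = comWeight t
  comWeight (letb u t) = weight u + comWeight u + comWeight t

  Bounded : Tm → Set
  Bounded (var y)    = ⊤
  Bounded (lam t)    = Bounded t × occ 0 t ≤ 1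
  Bounded (app t u)  = Bounded t × Bounded u
  Bounded (bang t)   = Bounded t
  Bounded (letb u t) = Bounded u × Bounded t × occ 0 t ≤ N

  measure : Tm → ℕ × ℕ
  measure t = weight t , comWeight t

  _≺_ : Tm → Tm → Set
  t' ≺ t = measure t' <lex measure t

  no≡0⇒occ≡0 : ∀ x t → no x t ≡ 0 → occ x t ≡ 0
  no≡0⇒occ≡0 x (var y)    no≡0 = no≡0
  no≡0⇒occ≡0 x (lam t)    no≡0 = no≡0⇒occ≡0 (suc x) t no≡0
  no≡0⇒occ≡0 x (app t u)  no≡0 =
    cong₂ _+_ (no≡0⇒occ≡0 x t (m+n≡0⇒m≡0 _ no≡0)) (no≡0⇒occ≡0 x u (m+n≡0⇒n≡0 _ no≡0))
  no≡0⇒occ≡0 x (bang t)   no≡0 = trans (cong (N *_) (no≡0⇒occ≡0 x t no≡0)) (*-zeroʳ N)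
  no≡0⇒occ≡0 x (letb u t) no≡0 =
    cong₂ _+_ (no≡0⇒occ≡0 x u (m+n≡0⇒m≡0 _ no≡0)) (no≡0⇒occ≡0 (suc x) t (m+n≡0⇒n≡0 _ no≡0))

  ∉TV⇒occ≡no : ∀ x t → ¬ x ∈TV t → occ x t ≡ no x t
  ∉TV⇒occ≡no x (var y)    x∉ = refl
  ∉TV⇒occ≡no x (lam t)    x∉ = ∉TV⇒occ≡no (suc x) t x∉
  ∉TV⇒occ≡no x (app t u)  x∉ =
    cong₂ _+_ (∉TV⇒occ≡no x t (λ x∈ → x∉ (inj₁ x∈))) (∉TV⇒occ≡no x u (λ x∈ → x∉ (inj₂ x∈)))
  ∉TV⇒occ≡no x (bang t)   x∉ = trans (no≡0⇒occ≡0 x (bang t) no≡0) (sym no≡0)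
    where
    no≡0 : no x t ≡ 0
    no≡0 = ∉FV⇒no≡0 x t x∉
  ∉TV⇒occ≡no x (letb u t) x∉ =
    cong₂ _+_ (∉TV⇒occ≡no x u (λ x∈ → x∉ (inj₁ x∈))) (∉TV⇒occ≡no (suc x) t (λ x∈ → x∉ (inj₂ x∈)))

  ∈TV⇒occ≡N : ∀ x t → IsTerm t → x ∈TV t → occ x t ≡ N
  ∈TV⇒occ≡N x (lam t) (t-lam term _ _) x∈ = ∈TV⇒occ≡N (suc x) t term x∈
  ∈TV⇒occ≡N x (app t u) (t-app term _ disjoint _) (inj₁ x∈)
    rewrite ∈TV⇒occ≡N x t term x∈ | no≡0⇒occ≡0 x u (∉FV⇒no≡0 x u (disjoint x x∈)) =
    +-identityʳ N
  ∈TV⇒occ≡N x (app t u) (t-app _ term _ disjoint) (inj₂ x∈)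
    rewrite ∈TV⇒occ≡N x u term x∈
          | no≡0⇒occ≡0 x t (∉FV⇒no≡0 x t (λ x∈t → disjoint x x∈t x∈)) = refl
  ∈TV⇒occ≡N x (bang t) (t-bang _ noTV linear) x∈
    rewrite ∉TV⇒occ≡no x t (noTV x) | linear x x∈ = *-identityʳ N
  ∈TV⇒occ≡N x (letb u t) (t-letb term _ disjoint _) (inj₁ x∈)
    rewrite ∈TV⇒occ≡N x u term x∈
          | no≡0⇒occ≡0 (suc x) t (∉FV⇒no≡0 (suc x) t (disjoint x x∈)) = +-identityʳ N
  ∈TV⇒occ≡N x (letb u t) (t-letb _ term _ disjoint) (inj₂ x∈)
    rewrite ∈TV⇒occ≡N (suc x) t term x∈
          | no≡0⇒occ≡0 x u (∉FV⇒no≡0 x u (λ x∈u → disjoint x x∈u x∈)) = refl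

  IsTerm⇒Bounded : ∀ t → IsTerm t → size t ≤ N → Bounded t
  IsTerm⇒Bounded (var x)    _ _ = tt
  IsTerm⇒Bounded (lam t) (t-lam term 0∉TV once) size≤N =
    IsTerm⇒Bounded t term (<⇒≤ size≤N) , ≤-trans (≤-reflexive (∉TV⇒occ≡no 0 t 0∉TV)) once
  IsTerm⇒Bounded (app t u) (t-app term-t term-u _ _) size≤N =
    IsTerm⇒Bounded t term-t (≤-trans (m≤m+n _ _) size≤N) ,
    IsTerm⇒Bounded u term-u (≤-trans (m≤n+m _ _) size≤N)
  IsTerm⇒Bounded (bang t) (t-bang term _ _) size≤N = IsTerm⇒Bounded t term (<⇒≤ size≤N)
  IsTerm⇒Bounded (letb u t) (t-letb term-u term-t _ _) size≤N =
    IsTerm⇒Bounded u term-u (≤-trans (m≤m+n _ _) sizes≤N) ,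
    IsTerm⇒Bounded t term-t (≤-trans (m≤n+m _ _) sizes≤N) ,
    occ0≤N
    where
    sizes≤N : size u + size t ≤ N
    sizes≤N = <⇒≤ size≤N
    occ0≤N : occ 0 t ≤ N
    occ0≤N with 0 ∈TV? t
    ... | yes 0∈    = ≤-reflexive (∈TV⇒occ≡N 0 t term-t 0∈)
    ... | Dec.no 0∉ = begin
      occ 0 t          ≡⟨ ∉TV⇒occ≡no 0 t 0∉ ⟩
      no 0 t           ≤⟨ no≤size 0 t ⟩
      size t           ≤⟨ m≤n+m (size t) (size u) ⟩
      size u + size t  ≤⟨ sizes≤N ⟩
      N                ∎
      where open ≤-Reasoning

  occ-shift-< : ∀ x c t → x < c → occ x (shift c t) ≡ occ x t
  occ-shift-< x c (var y) x<c with ≤-<-connex c y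
  ... | inj₂ y<c rewrite <⇒<ᵇ-true y<c = refl
  ... | inj₁ c≤y rewrite ≥⇒<ᵇ-false c≤y
                       | ≢⇒≡ᵇ-false (<⇒≢ (<-≤-trans x<c (m≤n⇒m≤1+n c≤y)))
                       | ≢⇒≡ᵇ-false (<⇒≢ (<-≤-trans x<c c≤y)) = refl
  occ-shift-< x c (lam t)    x<c = occ-shift-< (suc x) (suc c) t (s<s x<c)
  occ-shift-< x c (app t u)  x<c = cong₂ _+_ (occ-shift-< x c t x<c) (occ-shift-< x c u x<c)
  occ-shift-< x c (bang t)   x<c = cong (N *_) (occ-shift-< x c t x<c)
  occ-shift-< x c (letb u t) x<c =
    cong₂ _+_ (occ-shift-< x c u x<c) (occ-shift-< (suc x) (suc c) t (s<s x<c))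

  occ-shift-≥ : ∀ x c t → c ≤ x → occ (suc x) (shift c t) ≡ occ x t
  occ-shift-≥ x c (var y) c≤x with ≤-<-connex c y
  ... | inj₁ c≤y rewrite ≥⇒<ᵇ-false c≤y = refl
  ... | inj₂ y<c rewrite <⇒<ᵇ-true y<c
                       | ≢⇒≡ᵇ-false (>⇒≢ (<-≤-trans y<c (m≤n⇒m≤1+n c≤x)))
                       | ≢⇒≡ᵇ-false (>⇒≢ (<-≤-trans y<c c≤x)) = refl
  occ-shift-≥ x c (lam t)    c≤x = occ-shift-≥ (suc x) (suc c) t (s≤s c≤x)
  occ-shift-≥ x c (app t u)  c≤x = cong₂ _+_ (occ-shift-≥ x c t c≤x) (occ-shift-≥ x c u c≤x)
  occ-shift-≥ x c (bang t)   c≤x = cong (N *_) (occ-shift-≥ x c t c≤x)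
  occ-shift-≥ x c (letb u t) c≤x =
    cong₂ _+_ (occ-shift-≥ x c u c≤x) (occ-shift-≥ (suc x) (suc c) t (s≤s c≤x))

  occ-shift-≡ : ∀ c t → occ c (shift c t) ≡ 0
  occ-shift-≡ c (var y) with ≤-<-connex c y
  ... | inj₁ c≤y rewrite ≥⇒<ᵇ-false c≤y | ≢⇒≡ᵇ-false (<⇒≢ (s≤s c≤y)) = refl
  ... | inj₂ y<c rewrite <⇒<ᵇ-true y<c | ≢⇒≡ᵇ-false (>⇒≢ y<c) = refl
  occ-shift-≡ c (lam t)    = occ-shift-≡ (suc c) t
  occ-shift-≡ c (app t u)  = cong₂ _+_ (occ-shift-≡ c t) (occ-shift-≡ c u)
  occ-shift-≡ c (bang t)   = trans (cong (N *_) (occ-shift-≡ c t)) (*-zeroʳ N)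
  occ-shift-≡ c (letb u t) = cong₂ _+_ (occ-shift-≡ c u) (occ-shift-≡ (suc c) t)

  weight-shift : ∀ c t → weight (shift c t) ≡ weight t
  weight-shift c (var y) with y <ᵇ c
  ... | true  = refl
  ... | false = refl
  weight-shift c (lam t)    = cong suc (weight-shift (suc c) t)
  weight-shift c (app t u)  = cong suc (cong₂ _+_ (weight-shift c t) (weight-shift c u))
  weight-shift c (bang t)   = cong (λ w → suc (N * w)) (weight-shift c t)
  weight-shift c (letb u t) = cong suc (cong₂ _+_ (weight-shift c u) (weight-shift (suc c) t))

  comWeight-shift : ∀ c t → comWeight (shift c t) ≡ comWeight t
  comWeight-shift c (var y) with y <ᵇ c
  ... | true  = refl
  ... | false = refl
  comWeight-shift c (lam t)    = comWeight-shift (suc c) t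
  comWeight-shift c (app t u)
    rewrite weight-shift c t | comWeight-shift c t | comWeight-shift c u = refl
  comWeight-shift c (bang t)   = comWeight-shift c t
  comWeight-shift c (letb u t)
    rewrite weight-shift c u | comWeight-shift c u | comWeight-shift (suc c) t = refl

  Bounded-shift : ∀ c t → Bounded t → Bounded (shift c t)
  Bounded-shift c (var y) _ with y <ᵇ c
  ... | true  = tt
  ... | false = tt
  Bounded-shift c (lam t) (bt , once) =
    Bounded-shift (suc c) t bt , ≤-trans (≤-reflexive (occ-shift-< 0 (suc c) t z<s)) once
  Bounded-shift c (app t u)  (bt , bu) = Bounded-shift c t bt , Bounded-shift c u bu
  Bounded-shift c (bang t)   bt        = Bounded-shift c t bt
  Bounded-shift c (letb u t) (bu , bt , ≤N) =
    Bounded-shift c u bu , Bounded-shift (suc c) t bt ,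
    ≤-trans (≤-reflexive (occ-shift-< 0 (suc c) t z<s)) ≤N

  weight-subst : ∀ k u t → weight (subst k u t) ≡ weight t + occ k t * weight u
  weight-subst k u (var y) with <-cmp y k
  ... | tri< y<k _ _ rewrite ≢⇒≡ᵇ-false (<⇒≢ y<k) | <⇒<ᵇ-true y<k | ≢⇒≡ᵇ-false (>⇒≢ y<k) = refl
  ... | tri≈ _ refl _ rewrite ≡ᵇ-refl y = sym (+-identityʳ (weight u))
  ... | tri> _ _ k<y rewrite ≢⇒≡ᵇ-false (>⇒≢ k<y) | ≥⇒<ᵇ-false (<⇒≤ k<y) | ≢⇒≡ᵇ-false (<⇒≢ k<y) = refl
  weight-subst k u (lam t) rewrite weight-subst (suc k) (shift 0 u) t | weight-shift 0 u = refl
  weight-subst k u (app t s) rewrite weight-subst k u t | weight-subst k u s =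
    cong suc (collect-+ (weight t) (occ k t) (weight s) (occ k s) (weight u))
  weight-subst k u (bang t) rewrite weight-subst k u t =
    cong suc (collect-* N (weight t) (occ k t) (weight u))
  weight-subst k u (letb s t)
    rewrite weight-subst k u s | weight-subst (suc k) (shift 0 u) t | weight-shift 0 u =
    cong suc (collect-+ (weight s) (occ k s) (weight t) (occ (suc k) t) (weight u))

  occ-subst-≥ : ∀ x k u t → k ≤ x → occ x (subst k u t) ≡ occ (suc x) t + occ k t * occ x u
  occ-subst-≥ x k u (var y) k≤x with <-cmp y k
  ... | tri< y<k _ _
    rewrite ≢⇒≡ᵇ-false (<⇒≢ y<k) | <⇒<ᵇ-true y<k | ≢⇒≡ᵇ-false (>⇒≢ y<k)
          | ≢⇒≡ᵇ-false (>⇒≢ (<-≤-trans y<k k≤x))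
          | ≢⇒≡ᵇ-false (>⇒≢ (<-≤-trans y<k (m≤n⇒m≤1+n k≤x))) = refl
  ... | tri≈ _ refl _ rewrite ≡ᵇ-refl y | ≢⇒≡ᵇ-false (>⇒≢ (s≤s k≤x)) = sym (+-identityʳ (occ x u))
  occ-subst-≥ x k u (var (suc y)) k≤x | tri> _ _ k<y
    rewrite ≢⇒≡ᵇ-false (>⇒≢ k<y) | ≥⇒<ᵇ-false (<⇒≤ k<y) | ≢⇒≡ᵇ-false (<⇒≢ k<y) =
    sym (+-identityʳ _)
  occ-subst-≥ x k u (lam t) k≤x
    rewrite occ-subst-≥ (suc x) (suc k) (shift 0 u) t (s≤s k≤x) | occ-shift-≥ x 0 u z≤n = refl
  occ-subst-≥ x k u (app t s) k≤x rewrite occ-subst-≥ x k u t k≤x | occ-subst-≥ x k u s k≤x =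
    collect-+ (occ (suc x) t) (occ k t) (occ (suc x) s) (occ k s) (occ x u)
  occ-subst-≥ x k u (bang t) k≤x rewrite occ-subst-≥ x k u t k≤x =
    collect-* N (occ (suc x) t) (occ k t) (occ x u)
  occ-subst-≥ x k u (letb s t) k≤x
    rewrite occ-subst-≥ x k u s k≤x | occ-subst-≥ (suc x) (suc k) (shift 0 u) t (s≤s k≤x)
          | occ-shift-≥ x 0 u z≤n =
    collect-+ (occ (suc x) s) (occ k s) (occ (suc (suc x)) t) (occ (suc k) t) (occ x u)

  occ-subst-< : ∀ x k u t → x < k → occ x u ≡ 0 → occ x (subst k u t) ≡ occ x t
  occ-subst-< x k u (var y) x<k u∌x with <-cmp y k
  ... | tri< y<k _ _ rewrite ≢⇒≡ᵇ-false (<⇒≢ y<k) | <⇒<ᵇ-true y<k = refl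
  ... | tri≈ _ refl _ rewrite ≡ᵇ-refl y | ≢⇒≡ᵇ-false (<⇒≢ x<k) = u∌x
  occ-subst-< x k u (var (suc y)) x<k u∌x | tri> _ _ k<y
    rewrite ≢⇒≡ᵇ-false (>⇒≢ k<y) | ≥⇒<ᵇ-false (<⇒≤ k<y)
          | ≢⇒≡ᵇ-false (<⇒≢ (<-≤-trans x<k (≤-pred k<y)))
          | ≢⇒≡ᵇ-false (<⇒≢ (<-≤-trans x<k (<⇒≤ k<y))) = refl
  occ-subst-< x k u (lam t) x<k u∌x =
    occ-subst-< (suc x) (suc k) (shift 0 u) t (s<s x<k) (trans (occ-shift-≥ x 0 u z≤n) u∌x)
  occ-subst-< x k u (app t s) x<k u∌x =
    cong₂ _+_ (occ-subst-< x k u t x<k u∌x) (occ-subst-< x k u s x<k u∌x)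
  occ-subst-< x k u (bang t) x<k u∌x = cong (N *_) (occ-subst-< x k u t x<k u∌x)
  occ-subst-< x k u (letb s t) x<k u∌x =
    cong₂ _+_ (occ-subst-< x k u s x<k u∌x)
              (occ-subst-< (suc x) (suc k) (shift 0 u) t (s<s x<k) (trans (occ-shift-≥ x 0 u z≤n) u∌x))

  occ₀-subst-under-binder : ∀ k u t → occ 0 (subst (suc k) (shift 0 u) t) ≡ occ 0 t
  occ₀-subst-under-binder k u t = occ-subst-< 0 (suc k) (shift 0 u) t z<s (occ-shift-≡ 0 u)

  Bounded-subst : ∀ k u t → Bounded t → Bounded u → Bounded (subst k u t)
  Bounded-subst k u (var y) _ bu with y ≡ᵇ k
  ... | true  = bu
  ... | false with y <ᵇ k
  ...   | true  = tt
  ...   | false = tt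
  Bounded-subst k u (lam t) (bt , once) bu =
    Bounded-subst (suc k) (shift 0 u) t bt (Bounded-shift 0 u bu) ,
    ≤-trans (≤-reflexive (occ₀-subst-under-binder k u t)) once
  Bounded-subst k u (app t s)  (bt , bs) bu = Bounded-subst k u t bt bu , Bounded-subst k u s bs bu
  Bounded-subst k u (bang t)   bt        bu = Bounded-subst k u t bt bu
  Bounded-subst k u (letb s t) (bs , bt , ≤N) bu =
    Bounded-subst k u s bs bu ,
    Bounded-subst (suc k) (shift 0 u) t bt (Bounded-shift 0 u bu) ,
    ≤-trans (≤-reflexive (occ₀-subst-under-binder k u t)) ≤N

  occ-⟶ : ∀ {t t'} → t ⟶ t' → Bounded t → ∀ x → occ x t' ≤ occ x t
  occ-⟶ (β {t} {u}) ((_ , once) , _) x = begin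
    occ x (t [ u ])                    ≡⟨ occ-subst-≥ x 0 u t z≤n ⟩
    occ (suc x) t + occ 0 t * occ x u  ≤⟨ +-monoʳ-≤ (occ (suc x) t) (*-monoˡ-≤ (occ x u) once) ⟩
    occ (suc x) t + 1 * occ x u        ≡⟨ cong (occ (suc x) t +_) (*-identityˡ (occ x u)) ⟩
    occ (suc x) t + occ x u            ∎
    where open ≤-Reasoning
  occ-⟶ (bangR {u} {t}) (_ , _ , ≤N) x = begin
    occ x (t [ u ])                    ≡⟨ occ-subst-≥ x 0 u t z≤n ⟩
    occ (suc x) t + occ 0 t * occ x u  ≤⟨ +-monoʳ-≤ (occ (suc x) t) (*-monoˡ-≤ (occ x u) ≤N) ⟩
    occ (suc x) t + N * occ x u        ≡⟨ +-comm (occ (suc x) t) (N * occ x u) ⟩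
    N * occ x u + occ (suc x) t        ∎
    where open ≤-Reasoning
  occ-⟶ (com1 {t₁} {t₂} {t₃}) _ x = ≤-reflexive (begin
    occ x t₁ + (occ (suc x) t₂ + occ (suc (suc x)) (shift 1 t₃))
      ≡⟨ cong (λ o → occ x t₁ + (occ (suc x) t₂ + o)) (occ-shift-≥ (suc x) 1 t₃ (s≤s z≤n)) ⟩
    occ x t₁ + (occ (suc x) t₂ + occ (suc x) t₃)
      ≡⟨ +-assoc (occ x t₁) (occ (suc x) t₂) (occ (suc x) t₃) ⟨
    occ x t₁ + occ (suc x) t₂ + occ (suc x) t₃ ∎)
    where open ≡-Reasoning
  occ-⟶ (com2 {t₁} {t₂} {t₃}) _ x = ≤-reflexive (begin
    occ x t₁ + (occ (suc x) t₂ + occ (suc x) (shift 0 t₃))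
      ≡⟨ cong (λ o → occ x t₁ + (occ (suc x) t₂ + o)) (occ-shift-≥ x 0 t₃ z≤n) ⟩
    occ x t₁ + (occ (suc x) t₂ + occ x t₃)
      ≡⟨ +-assoc (occ x t₁) (occ (suc x) t₂) (occ x t₃) ⟨
    occ x t₁ + occ (suc x) t₂ + occ x t₃ ∎)
    where open ≡-Reasoning
  occ-⟶ (ξ-lam r)            (bt , _)     x = occ-⟶ r bt (suc x)
  occ-⟶ (ξ-appₗ {u = u} r)   (bt , _)     x = +-monoˡ-≤ (occ x u) (occ-⟶ r bt x)
  occ-⟶ (ξ-appᵣ {t = t} r)   (_ , bu)     x = +-monoʳ-≤ (occ x t) (occ-⟶ r bu x)
  occ-⟶ (ξ-bang r)           bt           x = *-monoʳ-≤ N (occ-⟶ r bt x)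
  occ-⟶ (ξ-letₗ {t = t} r)   (bu , _ , _) x = +-monoˡ-≤ (occ (suc x) t) (occ-⟶ r bu x)
  occ-⟶ (ξ-letᵣ {u = u} r)   (_ , bt , _) x = +-monoʳ-≤ (occ x u) (occ-⟶ r bt (suc x))

  Bounded-⟶ : ∀ {t t'} → t ⟶ t' → Bounded t → Bounded t'
  Bounded-⟶ (β {t} {u})     ((bt , _) , bu) = Bounded-subst 0 u t bt bu
  Bounded-⟶ (bangR {u} {t}) (bu , bt , _)   = Bounded-subst 0 u t bt bu
  Bounded-⟶ (com1 {t₁} {t₂} {t₃}) ((b₁ , b₂ , ≤N₂) , b₃ , ≤N₃)
    rewrite occ-shift-≡ 1 t₃ | occ-shift-< 0 1 t₃ z<s | +-identityʳ (occ 0 t₂) =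
    b₁ , (b₂ , Bounded-shift 1 t₃ b₃ , ≤N₃) , ≤N₂
  Bounded-⟶ (com2 {t₁} {t₂} {t₃}) ((b₁ , b₂ , ≤N₂) , b₃)
    rewrite occ-shift-≡ 0 t₃ | +-identityʳ (occ 0 t₂) =
    b₁ , (b₂ , Bounded-shift 0 t₃ b₃) , ≤N₂
  Bounded-⟶ (ξ-lam r)  (bt , once)     = Bounded-⟶ r bt , ≤-trans (occ-⟶ r bt 0) once
  Bounded-⟶ (ξ-appₗ r) (bt , bu)       = Bounded-⟶ r bt , bu
  Bounded-⟶ (ξ-appᵣ r) (bt , bu)       = bt , Bounded-⟶ r bu
  Bounded-⟶ (ξ-bang r) bt              = Bounded-⟶ r bt
  Bounded-⟶ (ξ-letₗ r) (bu , bt , ≤N)  = Bounded-⟶ r bu , bt , ≤N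
  Bounded-⟶ (ξ-letᵣ r) (bu , bt , ≤N)  = bu , Bounded-⟶ r bt , ≤-trans (occ-⟶ r bt 0) ≤N

  ≺-⟶ : ∀ {t t'} → t ⟶ t' → Bounded t → t' ≺ t
  ≺-⟶ (β {t} {u}) ((_ , once) , _) = inj₁ (begin-strict
    weight (t [ u ])                   ≡⟨ weight-subst 0 u t ⟩
    weight t + occ 0 t * weight u      ≤⟨ +-monoʳ-≤ (weight t) (*-monoˡ-≤ (weight u) once) ⟩
    weight t + 1 * weight u            ≡⟨ cong (weight t +_) (*-identityˡ (weight u)) ⟩
    weight t + weight u                <⟨ m<n⇒m<1+n (n<1+n _) ⟩
    suc (suc (weight t) + weight u)    ∎)
    where open ≤-Reasoning
  ≺-⟶ (bangR {u} {t}) (_ , _ , ≤N) = inj₁ (begin-strict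
    weight (t [ u ])                   ≡⟨ weight-subst 0 u t ⟩
    weight t + occ 0 t * weight u      ≤⟨ +-monoʳ-≤ (weight t) (*-monoˡ-≤ (weight u) ≤N) ⟩
    weight t + N * weight u            ≡⟨ +-comm (weight t) (N * weight u) ⟩
    N * weight u + weight t            <⟨ m<n⇒m<1+n (n<1+n _) ⟩
    suc (suc (N * weight u) + weight t) ∎)
    where open ≤-Reasoning
  ≺-⟶ (com1 {t₁} {t₂} {t₃}) _ rewrite weight-shift 1 t₃ | comWeight-shift 1 t₃ =
    <lex-commute (weight t₁) (weight t₂) (weight t₃) (comWeight t₁) (comWeight t₂) (comWeight t₃)
  ≺-⟶ (com2 {t₁} {t₂} {t₃}) _ rewrite weight-shift 0 t₃ | comWeight-shift 0 t₃ =
    <lex-commute (weight t₁) (weight t₂) (weight t₃) (comWeight t₁) (comWeight t₂) (comWeight t₃)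
  ≺-⟶ (ξ-lam r) (bt , _) = <lex-map₁ suc s<s (≺-⟶ r bt)
  ≺-⟶ (ξ-appₗ {u = u} r) (bt , _) = <lex-nodeˡ (weight u) (comWeight u) (≺-⟶ r bt)
  ≺-⟶ (ξ-appᵣ {t = t} r) (_ , bu) = <lex-nodeʳ (weight t) (comWeight t) (≺-⟶ r bu)
  ≺-⟶ (ξ-bang r) bt = <lex-map₁ (λ w → suc (N * w)) (λ lt → s<s (*-monoʳ-< N lt)) (≺-⟶ r bt)
  ≺-⟶ (ξ-letₗ {t = t} r) (bu , _) = <lex-nodeˡ (weight t) (comWeight t) (≺-⟶ r bu)
  ≺-⟶ (ξ-letᵣ {u = u} r) (_ , bt , _) = <lex-nodeʳ (weight u) (comWeight u) (≺-⟶ r bt)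

  comWeight≤weight² : ∀ t → comWeight t ≤ weight t * weight t
  comWeight≤weight² (var y)    = z≤n
  comWeight≤weight² (lam t)    =
    ≤-trans (comWeight≤weight² t) (*-mono-≤ (n≤1+n (weight t)) (n≤1+n (weight t)))
  comWeight≤weight² (app t u)  = node-square (comWeight≤weight² t) (comWeight≤weight² u)
  comWeight≤weight² (bang t)   = ≤-trans (comWeight≤weight² t) (*-mono-≤ w≤ w≤)
    where
    w≤ : weight t ≤ suc (N * weight t)
    w≤ = m≤n⇒m≤1+n (m≤n*m (weight t) N)
  comWeight≤weight² (letb u t) = node-square (comWeight≤weight² u) (comWeight≤weight² t)

  node-weight-< : ∀ {a b} s r d e → a < s * N ^ d → b < r * N ^ e →
    suc (a + b) < (s + r) * N ^ (d ⊔ e)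
  node-weight-< {a} {b} s r d e a< b< = begin-strict
    suc (a + b)                        <⟨ n<1+n _ ⟩
    suc (suc (a + b))                  ≡⟨ cong suc (+-suc a b) ⟨
    suc a + suc b                      ≤⟨ +-mono-≤ a< b< ⟩
    s * N ^ d + r * N ^ e              ≤⟨ +-mono-≤ (raise s (m≤m⊔n d e)) (raise r (m≤n⊔m d e)) ⟩
    s * N ^ (d ⊔ e) + r * N ^ (d ⊔ e)  ≡⟨ *-distribʳ-+ (N ^ (d ⊔ e)) s r ⟨
    (s + r) * N ^ (d ⊔ e)              ∎
    where
    open ≤-Reasoning
    raise : ∀ k {d D} → d ≤ D → k * N ^ d ≤ k * N ^ D
    raise k d≤D = *-monoʳ-≤ k (^-monoʳ-≤ N d≤D)

  weight<size*N^depth : ∀ t → weight t < size t * N ^ depth t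
  weight<size*N^depth (var y)    = z<s
  weight<size*N^depth (lam t)    = ≤-<-trans (weight<size*N^depth t) (m<n+m _ (m^n>0 N (depth t)))
  weight<size*N^depth (app t u)  =
    node-weight-< (size t) (size u) (depth t) (depth u) (weight<size*N^depth t) (weight<size*N^depth u)
  weight<size*N^depth (bang t)   = begin-strict
    suc (N * weight t)             ≤⟨ +-monoˡ-≤ (N * weight t) (>-nonZero⁻¹ N) ⟩
    N + N * weight t               ≡⟨ *-suc N (weight t) ⟨
    N * suc (weight t)             ≤⟨ *-monoʳ-≤ N (weight<size*N^depth t) ⟩
    N * (size t * N ^ depth t)     ≡⟨ x∙yz≈y∙xz N (size t) (N ^ depth t) ⟩
    size t * N ^ suc (depth t)     <⟨ m<n+m _ (m^n>0 N (suc (depth t))) ⟩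
    suc (size t) * N ^ suc (depth t) ∎
    where open ≤-Reasoning
  weight<size*N^depth (letb u t) =
    <-trans (node-weight-< (size u) (size t) (depth u) (depth t)
                           (weight<size*N^depth u) (weight<size*N^depth t))
            (m<n+m _ (m^n>0 N (depth u ⊔ depth t)))

  Within : ℕ → Tm → Set
  Within Q t = Bounded t × weight t < Q

  potential : ℕ → Tm → ℕ
  potential K t = weight t * K + comWeight t

  comWeight<square : ∀ {Q} t → weight t < Q → comWeight t < Q * Q
  comWeight<square t w<Q = ≤-<-trans (comWeight≤weight² t) (*-mono-< w<Q w<Q)

  potential-⟶ : ∀ Q {t t'} → t ⟶ t' → Within Q t →
    Within Q t' × potential (Q * Q) t' < potential (Q * Q) t
  potential-⟶ Q {t} {t'} r (bt , w<Q) =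
    (Bounded-⟶ r bt , w'<Q) , <lex⇒weighted-< (Q * Q) (comWeight<square t' w'<Q) t'≺t
    where
    t'≺t : t' ≺ t
    t'≺t = ≺-⟶ r bt
    w'<Q : weight t' < Q
    w'<Q = ≤-<-trans (<lex⇒≤₁ t'≺t) w<Q

reduction-length : ∀ {t t' m} → IsTerm t → t ⟶[ m ] t' → m ≤ size t ^ (3 * depth t + 3)
reduction-length {t} {m = m} term red = begin
  m                           ≤⟨ length≤measure (Within Q) (potential (Q * Q)) (potential-⟶ Q) red
                                   (IsTerm⇒Bounded t term ≤-refl , w<Q) ⟩
  potential (Q * Q) t         <⟨ m*o+n<[1+m]*o (weight t) (Q * Q) (comWeight<square t w<Q) ⟩
  suc (weight t) * (Q * Q)    ≤⟨ *-monoˡ-≤ (Q * Q) w<Q ⟩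
  Q * (Q * Q)                 ≡⟨ ^-cube (size t) (depth t) ⟨
  size t ^ (3 * depth t + 3)  ∎
  where
  open WeightedMeasure (size t) {{>-nonZero (size>0 t)}}
  open ≤-Reasoning
  Q : ℕ
  Q = size t ^ suc (depth t)
  w<Q : weight t < Q
  w<Q = weight<size*N^depth t

monomial : ℕ → List ℕ
monomial zero    = 1 ∷ []
monomial (suc e) = 0 ∷ monomial e

length-monomial : ∀ e → length (monomial e) ≡ suc e
length-monomial zero    = refl
length-monomial (suc e) = cong suc (length-monomial e)

eval-monomial : ∀ e n → eval (monomial e) n ≡ n ^ e
eval-monomial zero    n = cong suc (*-zeroʳ n)
eval-monomial (suc e) n = cong (n *_) (eval-monomial e n)

mainTheorem1 : Σ ℕ λ a → Σ ℕ λ b → (d : ℕ) →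
    Σ (List ℕ) λ P → (length P ≤ suc (a * d + b)) ×
      ((t : Tm) → IsTerm t → depth t ≡ d →
        (m : ℕ) (t' : Tm) → t ⟶[ m ] t' → m ≤ eval P (size t))
mainTheorem1 = 3 , 3 , λ d →
  monomial (3 * d + 3) ,
  ≤-reflexive (length-monomial (3 * d + 3)) ,
  λ { t term refl m t' red → begin
        m                                   ≤⟨ reduction-length term red ⟩
        size t ^ (3 * depth t + 3)          ≡⟨ eval-monomial (3 * depth t + 3) (size t) ⟨
        eval (monomial (3 * depth t + 3)) (size t) ∎ }
  where open ≤-Reasoning
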